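{- Bisimilarity $\sim^\Lambda$ on the $B(\Lambda,-)$-coalgebra $\langle\gamma_1,\gamma_2\rangle\colon\Lambda\to\langle\!\langle\Lambda,\Lambda\rangle\!\rangle\times(\Lambda+\Lambda^\Lambda+1)$ (i.e. the greatest bisimulation from this coalgebra to itself) coincides with the open extension $\sim^{\mathrm{ap}}$ of strong applicative bisimilarity.
   Context: $\mathbb{F}$: finite cardinals $n=\{0,\dots,n-1\}$ and all functions; presheaves are functors $\mathbb{F}\to\mathbf{Set}$. $\Lambda(n)$: untyped $\lambda$-terms modulo $\alpha$-equivalence with free variables among $0,\dots,n-1$ (renaming gives the presheaf action); $\lambda.t'=\lambda x.t'$ binds $x=n$ in $t'\in\Lambda(n+1)$. $\to$ is call-by-name reduction: $p\to p'$ implies $p\,q\to p'\,q$, and $(\lambda x.p)\,q\to p[q/x]$. $\langle\!\langle X,Y\rangle\!\rangle(n)=\mathrm{Nat}(X^n,Y)$; $Y^X(n)=\mathrm{Nat}(\mathbb{F}(n,-)\times X,Y)$ with $f(e):=f_n(\mathrm{id}_n,e)$; $B(X,Y)=\langle\!\langle X,Y\rangle\!\rangle\times(Y+Y^X+1)$. A bisimulation on a $B(\Lambda,-)$-coalgebra $W\to B(\Lambda,W)$ is a sub-presheaf $R\subseteq W\times W$ with a coalgebra structure making both projections coalgebra morphisms. The coalgebra $\langle\gamma_1,\gamma_2\rangle$ is the unique family satisfying, for $\vec u\in\Lambda(m)^n$: for a variable $v\in n$, $\gamma_1(v)(\vec u)=u_v$, $\gamma_2(v)=*$; for $t'\in\Lambda(n+1)$,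 $\gamma_1(\lambda.t')(\vec u)=\lambda.(\gamma_1(t')(\mathrm{up}(\vec u),m))$ (weakening $\vec u$ to $\Lambda(m+1)$, $m$ the new variable) and $\gamma_2(\lambda.t')\in\Lambda^\Lambda(n)$ is $(r,e)\in\mathbb{F}(n,k)\times\Lambda(k)\mapsto\gamma_1(t')(r(0),\dots,r(n-1),e)$; $\gamma_1(t_1t_2)(\vec u)=\gamma_1(t_1)(\vec u)\,\gamma_1(t_2)(\vec u)$, and $\gamma_2(t_1t_2)$ is $\gamma_2(t_1)\,t_2$, $\gamma_2(t_1)(t_2)$ or $*$ according as $\gamma_2(t_1)$ lies in $\Lambda(n)$, $\Lambda^\Lambda(n)$, or equals $*$. Strong applicative bisimilarity $\sim^{\mathrm{ap}}_0\subseteq\Lambda(0)\times\Lambda(0)$ is the greatest relation such that whenever $t_1\sim^{\mathrm{ap}}_0t_2$: (A1) $t_1\to t_1'$ implies $t_2\to t_2'$ with $t_1'\sim^{\mathrm{ap}}_0t_2'$; (A2) $t_1=\lambda x.t_1'$ implies $t_2=\lambda x.t_2'$ with $t_1'[e/x]\sim^{\mathrm{ap}}_0t_2'[e/x]$ for all $e\in\Lambda(0)$; (A3),(A4) the symmetric conditions with $t_1,t_2$ swapped. Its open extension $\sim^{\mathrm{ap}}\subseteq\Lambda\times\Lambda$ has $\sim^{\mathrm{ap}}_0$ at $0$ and, for $n>0$, $t_1\sim^{\mathrm{ap}}_nt_2$ iff $t_1[\vec u]\sim^{\mathrm{ap}}_0t_2[\vec u]$ for every $\vec u\in\Lambda(0)^n$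 (simultaneous substitution). -}

module Defs where

open import Data.Nat using (ℕ; zero; suc)
open import Data.Fin using (Fin; zero; suc; inject₁; fromℕ)
open import Data.Product using (Σ; Σ-syntax; _×_; _,_; proj₁; proj₂)
open import Function using (_∘_; id)
open import Relation.Binary.PropositionalEquality hiding (resp)
open import Relation.Binary.Structures using (IsEquivalence)

-- Finite-cardinal utilities.  Fin (suc n) = {0,…,n}; the "new" element
-- is the last one, fromℕ n, and the old ones are inject₁ i.

snoc : ∀ {n} {A : Set} → (Fin n → A) → A → Fin (suc n) → A
snoc {zero}  f a zero    = a
snoc {suc n} f a zero    = f zero
snoc {suc n} f a (suc i) = snoc (λ j → f (suc j)) a i

snoc-inj : ∀ {n} {A : Set} (f : Fin n → A) (a : A) (i : Fin n) → snoc f a (inject₁ i) ≡ f i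
snoc-inj {suc n} f a zero    = refl
snoc-inj {suc n} f a (suc i) = snoc-inj (λ j → f (suc j)) a i

snoc-last : ∀ {n} {A : Set} (f : Fin n → A) (a : A) → snoc f a (fromℕ n) ≡ a
snoc-last {zero}  f a = refl
snoc-last {suc n} f a = snoc-last (λ j → f (suc j)) a

snoc-eta : ∀ {n} {A : Set} (g : Fin (suc n) → A) (i : Fin (suc n)) →
           snoc (λ j → g (inject₁ j)) (g (fromℕ n)) i ≡ g i
snoc-eta {zero}  g zero    = refl
snoc-eta {suc n} g zero    = refl
snoc-eta {suc n} g (suc i) = snoc-eta (λ j → g (suc j)) i

snoc-map : ∀ {n} {A B : Set} (h : A → B) (f : Fin n → A) (a : A) (i : Fin (suc n)) →
           h (snoc f a i) ≡ snoc (λ j → h (f j)) (h a) i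
snoc-map {zero}  h f a zero    = refl
snoc-map {suc n} h f a zero    = refl
snoc-map {suc n} h f a (suc i) = snoc-map h (λ j → f (suc j)) a i

snoc-cong : ∀ {n} {A : Set} {f g : Fin n → A} {a b : A} → (∀ i → f i ≡ g i) → a ≡ b →
            ∀ i → snoc f a i ≡ snoc g b i
snoc-cong {zero}  p q zero    = q
snoc-cong {suc n} p q zero    = p zero
snoc-cong {suc n} p q (suc i) = snoc-cong (λ j → p (suc j)) q i

-- Untyped λ-terms with free variables among 0,…,n-1 (de Bruijn levels
-- style: α-equivalence is syntactic identity).  lam t' binds the
-- variable n = fromℕ n of t' ∈ Λ (suc n).

data Λ (n : ℕ) : Set where
  var : Fin n → Λ n
  lam : Λ (suc n) → Λ n
  app : Λ n → Λ n → Λ n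

ext : ∀ {n m} → (Fin n → Fin m) → Fin (suc n) → Fin (suc m)
ext {n} {m} f = snoc (λ i → inject₁ (f i)) (fromℕ m)

ren : ∀ {n m} → (Fin n → Fin m) → Λ n → Λ m
ren f (var i)   = var (f i)
ren f (lam t)   = lam (ren (ext f) t)
ren f (app t u) = app (ren f t) (ren f u)

up : ∀ {n m} → (Fin n → Λ m) → Fin (suc n) → Λ (suc m)
up {n} {m} σ = snoc (λ i → ren inject₁ (σ i)) (var (fromℕ m))

sub : ∀ {n m} → (Fin n → Λ m) → Λ n → Λ m
sub σ (var i)   = σ i
sub σ (lam t)   = lam (sub (up σ) t)
sub σ (app t u) = app (sub σ t) (sub σ u)

_[_/x] : ∀ {n} → Λ (suc n) → Λ n → Λ n
p [ q /x] = sub (snoc var q) p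

data _⟶_ {n : ℕ} : Λ n → Λ n → Set where
  appL : ∀ {p p' q} → p ⟶ p' → app p q ⟶ app p' q
  β    : ∀ {p q} → app (lam p) q ⟶ (p [ q /x])

ren-cong : ∀ {n m} {f g : Fin n → Fin m} → (∀ i → f i ≡ g i) → ∀ t → ren f t ≡ ren g t
ren-cong p (var i)   = cong var (p i)
ren-cong p (lam t)   = cong lam (ren-cong (snoc-cong (λ i → cong inject₁ (p i)) refl) t)
ren-cong p (app t u) = cong₂ app (ren-cong p t) (ren-cong p u)

ren-id : ∀ {n} {f : Fin n → Fin n} → (∀ i → f i ≡ i) → ∀ t → ren f t ≡ t
ren-id p (var i)   = cong var (p i)
ren-id p (lam t)   = cong lam (ren-id (λ i → trans (snoc-cong (λ j → cong inject₁ (p j)) refl i)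
                                                   (snoc-eta (λ j → j) i)) t)
ren-id p (app t u) = cong₂ app (ren-id p t) (ren-id p u)

ext-∘ : ∀ {n m k} (f : Fin n → Fin m) (g : Fin m → Fin k) (i : Fin (suc n)) →
        ext g (ext f i) ≡ ext (λ j → g (f j)) i
ext-∘ {n} {m} {k} f g i =
  trans (snoc-map (ext g) (λ j → inject₁ (f j)) (fromℕ m) i)
        (snoc-cong (λ j → snoc-inj (λ l → inject₁ (g l)) (fromℕ k) (f j))
                   (snoc-last (λ l → inject₁ (g l)) (fromℕ k)) i)

ren-ren : ∀ {n m k} (f : Fin n → Fin m) (g : Fin m → Fin k) t →
          ren g (ren f t) ≡ ren (λ i → g (f i)) t
ren-ren f g (var i)   = refl
ren-ren f g (lam t)   = cong lam (trans (ren-ren (ext f) (ext g) t) (ren-cong (ext-∘ f g) t))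
ren-ren f g (app t u) = cong₂ app (ren-ren f g t) (ren-ren f g u)

sub-cong : ∀ {n m} {σ τ : Fin n → Λ m} → (∀ i → σ i ≡ τ i) → ∀ t → sub σ t ≡ sub τ t
sub-cong p (var i)   = p i
sub-cong p (lam t)   = cong lam (sub-cong (snoc-cong (λ i → cong (ren inject₁) (p i)) refl) t)
sub-cong p (app t u) = cong₂ app (sub-cong p t) (sub-cong p u)

ren-up : ∀ {n m k} (g : Fin m → Fin k) (σ : Fin n → Λ m) (i : Fin (suc n)) →
         ren (ext g) (up σ i) ≡ up (λ j → ren g (σ j)) i
ren-up {n} {m} {k} g σ i =
  trans (snoc-map (ren (ext g)) (λ j → ren inject₁ (σ j)) (var (fromℕ m)) i)
        (snoc-cong (λ j → trans (ren-ren inject₁ (ext g) (σ j))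
                          (trans (ren-cong (snoc-inj (λ l → inject₁ (g l)) (fromℕ k)) (σ j))
                                 (sym (ren-ren g inject₁ (σ j)))))
                   (cong var (snoc-last (λ l → inject₁ (g l)) (fromℕ k))) i)

ren-sub : ∀ {n m k} (g : Fin m → Fin k) (σ : Fin n → Λ m) t →
          ren g (sub σ t) ≡ sub (λ i → ren g (σ i)) t
ren-sub g σ (var i)   = refl
ren-sub g σ (lam t)   = cong lam (trans (ren-sub (ext g) (up σ) t) (sub-cong (ren-up g σ) t))
ren-sub g σ (app t u) = cong₂ app (ren-sub g σ t) (ren-sub g σ u)

up-ext : ∀ {n m k} (f : Fin n → Fin m) (σ : Fin m → Λ k) (i : Fin (suc n)) →
         up σ (ext f i) ≡ up (λ j → σ (f j)) i
up-ext {n} {m} {k} f σ i =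
  trans (snoc-map (up σ) (λ j → inject₁ (f j)) (fromℕ m) i)
        (snoc-cong (λ j → snoc-inj (λ l → ren inject₁ (σ l)) (var (fromℕ k)) (f j))
                   (snoc-last (λ l → ren inject₁ (σ l)) (var (fromℕ k))) i)

sub-ren : ∀ {n m k} (f : Fin n → Fin m) (σ : Fin m → Λ k) t →
          sub σ (ren f t) ≡ sub (λ i → σ (f i)) t
sub-ren f σ (var i)   = refl
sub-ren f σ (lam t)   = cong lam (trans (sub-ren (ext f) (up σ) t) (sub-cong (up-ext f σ) t))
sub-ren f σ (app t u) = cong₂ app (sub-ren f σ t) (sub-ren f σ u)

-- Equality of elements is given by an equivalence
-- relation (setoid-valued presheaves), because the sets ⟪X,Y⟫(n),
-- Y^X(n) consist of natural transformations, which are compared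
-- extensionally.  A morphism of 𝔽 is a function Fin n → Fin m; two
-- pointwise equal functions are the same morphism (act-ext).

record Psh : Set₁ where
  field
    Ob       : ℕ → Set
    _≈_      : ∀ {n} → Ob n → Ob n → Set
    ≈-equiv  : ∀ {n} → IsEquivalence (_≈_ {n})
    act      : ∀ {n m} → (Fin n → Fin m) → Ob n → Ob m
    act-resp : ∀ {n m} (f : Fin n → Fin m) {x y : Ob n} → x ≈ y → act f x ≈ act f y
    act-ext  : ∀ {n m} {f g : Fin n → Fin m} → (∀ i → f i ≡ g i) → ∀ x → act f x ≈ act g x
    act-id   : ∀ {n} (x : Ob n) → act (λ i → i) x ≈ x
    act-∘    : ∀ {n m k} (f : Fin n → Fin m) (g : Fin m → Fin k) (x : Ob n) →
               act (λ i → g (f i)) x ≈ act g (act f x)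

open Psh

record PshHom (X Y : Psh) : Set where
  field
    map  : ∀ {n} → Ob X n → Ob Y n
    hresp : ∀ {n} {x x' : Ob X n} → _≈_ X x x' → _≈_ Y (map x) (map x')
    hnat  : ∀ {n m} (f : Fin n → Fin m) (x : Ob X n) → _≈_ Y (act Y f (map x)) (map (act X f x))

open PshHom

module _ (X Y : Psh) where

  -- ⟪X,Y⟫(n) = Nat(X^n, Y)
  record Clo (n : ℕ) : Set where
    field
      apply : ∀ {m} → (Fin n → Ob X m) → Ob Y m
      resp  : ∀ {m} {u v : Fin n → Ob X m} → (∀ i → _≈_ X (u i) (v i)) →
              _≈_ Y (apply u) (apply v)
      nat   : ∀ {m k} (f : Fin m → Fin k) (u : Fin n → Ob X m) →
              _≈_ Y (act Y f (apply u)) (apply (λ i → act X f (u i)))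

  -- Y^X(n) = Nat(𝔽(n,-) × X, Y)
  record Exp (n : ℕ) : Set where
    field
      apply : ∀ {k} → (Fin n → Fin k) → Ob X k → Ob Y k
      resp  : ∀ {k} {r r' : Fin n → Fin k} {e e' : Ob X k} → (∀ i → r i ≡ r' i) →
              _≈_ X e e' → _≈_ Y (apply r e) (apply r' e')
      nat   : ∀ {k l} (g : Fin k → Fin l) (r : Fin n → Fin k) (e : Ob X k) →
              _≈_ Y (act Y g (apply r e)) (apply (λ i → g (r i)) (act X g e))

  data Res (n : ℕ) : Set where
    ι₁ : Ob Y n → Res n
    ι₂ : Exp n → Res n
    ι₃ : Res n

  B : ℕ → Set
  B n = Clo n × Res n

  Clo≈ : ∀ {n} → Clo n → Clo n → Set
  Clo≈ φ ψ = ∀ {m} (u : Fin _ → Ob X m) → _≈_ Y (Clo.apply φ u) (Clo.apply ψ u)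

  Exp≈ : ∀ {n} → Exp n → Exp n → Set
  Exp≈ φ ψ = ∀ {k} (r : Fin _ → Fin k) (e : Ob X k) → _≈_ Y (Exp.apply φ r e) (Exp.apply ψ r e)

  data Res≈ {n : ℕ} : Res n → Res n → Set where
    ι₁ : ∀ {y y'} → _≈_ Y y y' → Res≈ (ι₁ y) (ι₁ y')
    ι₂ : ∀ {φ ψ} → Exp≈ φ ψ → Res≈ (ι₂ φ) (ι₂ ψ)
    ι₃ : Res≈ ι₃ ι₃

  B≈ : ∀ {n} → B n → B n → Set
  B≈ (φ , ρ) (ψ , ρ') = Clo≈ φ ψ × Res≈ ρ ρ'

  Clo-act : ∀ {n n'} → (Fin n → Fin n') → Clo n → Clo n'
  Clo-act f φ = record
    { apply = λ u → Clo.apply φ (λ i → u (f i))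
    ; resp  = λ p → Clo.resp φ (λ i → p (f i))
    ; nat   = λ g u → Clo.nat φ g (λ i → u (f i)) }

  Exp-act : ∀ {n n'} → (Fin n → Fin n') → Exp n → Exp n'
  Exp-act f φ = record
    { apply = λ r e → Exp.apply φ (λ i → r (f i)) e
    ; resp  = λ p q → Exp.resp φ (λ i → p (f i)) q
    ; nat   = λ g r e → Exp.nat φ g (λ i → r (f i)) e }

  Res-act : ∀ {n n'} → (Fin n → Fin n') → Res n → Res n'
  Res-act f (ι₁ y) = ι₁ (act Y f y)
  Res-act f (ι₂ φ) = ι₂ (Exp-act f φ)
  Res-act f ι₃     = ι₃

  B-act : ∀ {n n'} → (Fin n → Fin n') → B n → B n'
  B-act f (φ , ρ) = Clo-act f φ , Res-act f ρ

module _ {X Y Z : Psh} (h : PshHom Y Z) where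

  private
    trZ : ∀ {n} {a b c : Ob Z n} → _≈_ Z a b → _≈_ Z b c → _≈_ Z a c
    trZ = IsEquivalence.trans (≈-equiv Z)

  Clo-map : ∀ {n} → Clo X Y n → Clo X Z n
  Clo-map φ = record
    { apply = λ u → map h (Clo.apply φ u)
    ; resp  = λ p → hresp h (Clo.resp φ p)
    ; nat   = λ f u → trZ (hnat h f (Clo.apply φ u)) (hresp h (Clo.nat φ f u)) }

  Exp-map : ∀ {n} → Exp X Y n → Exp X Z n
  Exp-map φ = record
    { apply = λ r e → map h (Exp.apply φ r e)
    ; resp  = λ p q → hresp h (Exp.resp φ p q)
    ; nat   = λ g r e → trZ (hnat h g (Exp.apply φ r e)) (hresp h (Exp.nat φ g r e)) }

  Res-map : ∀ {n} → Res X Y n → Res X Z n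
  Res-map (ι₁ y) = ι₁ (map h y)
  Res-map (ι₂ φ) = ι₂ (Exp-map φ)
  Res-map ι₃     = ι₃

  B-map : ∀ {n} → B X Y n → B X Z n
  B-map (φ , ρ) = Clo-map φ , Res-map ρ

record IsCoalgStr (X W : Psh) (str : ∀ {n} → Ob W n → B X W n) : Set where
  field
    str-resp : ∀ {n} {w w' : Ob W n} → _≈_ W w w' → B≈ X W (str w) (str w')
    str-nat  : ∀ {n m} (f : Fin n → Fin m) (w : Ob W n) →
               B≈ X W (B-act X W f (str w)) (str (act W f w))

record Coalg (X : Psh) : Set₁ where
  field
    W       : Psh
    str     : ∀ {n} → Ob W n → B X W n
    isCoalg : IsCoalgStr X W str

open Coalg

IsCoalgHom : ∀ {X} (C D : Coalg X) → PshHom (W C) (W D) → Set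
IsCoalgHom {X} C D h = ∀ {n} (w : Ob (W C) n) → B≈ X (W D) (B-map h (str C w)) (str D (map h w))

record SubRel (W : Psh) : Set₁ where
  field
    Rel      : ∀ {n} → Ob W n → Ob W n → Set
    Rel-resp : ∀ {n} {a a' b b' : Ob W n} → _≈_ W a a' → _≈_ W b b' → Rel a b → Rel a' b'
    Rel-act  : ∀ {n m} (f : Fin n → Fin m) {a b : Ob W n} → Rel a b → Rel (act W f a) (act W f b)

SubPsh : ∀ {W} → SubRel W → Psh
SubPsh {W} R = record
  { Ob       = λ n → Σ[ p ∈ Ob W n × Ob W n ] SubRel.Rel R (proj₁ p) (proj₂ p)
  ; _≈_      = λ x y → _≈_ W (proj₁ (proj₁ x)) (proj₁ (proj₁ y)) × _≈_ W (proj₂ (proj₁ x)) (proj₂ (proj₁ y))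
  ; ≈-equiv  = record
      { refl  = IsEquivalence.refl (≈-equiv W) , IsEquivalence.refl (≈-equiv W)
      ; sym   = λ p → IsEquivalence.sym (≈-equiv W) (proj₁ p) , IsEquivalence.sym (≈-equiv W) (proj₂ p)
      ; trans = λ p q → IsEquivalence.trans (≈-equiv W) (proj₁ p) (proj₁ q)
                      , IsEquivalence.trans (≈-equiv W) (proj₂ p) (proj₂ q) }
  ; act      = λ f x → (act W f (proj₁ (proj₁ x)) , act W f (proj₂ (proj₁ x))) , SubRel.Rel-act R f (proj₂ x)
  ; act-resp = λ f p → act-resp W f (proj₁ p) , act-resp W f (proj₂ p)
  ; act-ext  = λ p x → act-ext W p (proj₁ (proj₁ x)) , act-ext W p (proj₂ (proj₁ x))
  ; act-id   = λ x → act-id W (proj₁ (proj₁ x)) , act-id W (proj₂ (proj₁ x))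
  ; act-∘    = λ f g x → act-∘ W f g (proj₁ (proj₁ x)) , act-∘ W f g (proj₂ (proj₁ x)) }

π₁ : ∀ {W} (R : SubRel W) → PshHom (SubPsh R) W
π₁ {W} R = record { map = λ x → proj₁ (proj₁ x) ; hresp = proj₁
                  ; hnat = λ f x → IsEquivalence.refl (≈-equiv W) }

π₂ : ∀ {W} (R : SubRel W) → PshHom (SubPsh R) W
π₂ {W} R = record { map = λ x → proj₂ (proj₁ x) ; hresp = proj₂
                  ; hnat = λ f x → IsEquivalence.refl (≈-equiv W) }

record Bisimulation {X : Psh} (C : Coalg X) : Set₁ where
  field
    rel      : SubRel (W C)
    rstr     : ∀ {n} → Ob (SubPsh rel) n → B X (SubPsh rel) n
    risCoalg : IsCoalgStr X (SubPsh rel) rstr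
  coalgR : Coalg X
  coalgR = record { W = SubPsh rel ; str = rstr ; isCoalg = risCoalg }
  field
    π₁-hom : IsCoalgHom coalgR C (π₁ rel)
    π₂-hom : IsCoalgHom coalgR C (π₂ rel)

-- bisimilarity = the greatest bisimulation = union of all bisimulations
_⊢_∼_ : ∀ {X} (C : Coalg X) {n} → Ob (W C) n → Ob (W C) n → Set₁
C ⊢ w₁ ∼ w₂ = Σ[ R ∈ Bisimulation C ] SubRel.Rel (Bisimulation.rel R) w₁ w₂

ΛP : Psh
ΛP = record
  { Ob       = Λ
  ; _≈_      = _≡_
  ; ≈-equiv  = isEquivalence
  ; act      = ren
  ; act-resp = λ f → cong (ren f)
  ; act-ext  = ren-cong
  ; act-id   = ren-id (λ i → refl)
  ; act-∘    = λ f g x → sym (ren-ren f g x) }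

γ₁ : ∀ {n} → Λ n → Clo ΛP ΛP n
γ₁ t = record
  { apply = λ u → sub u t
  ; resp  = λ p → sub-cong p t
  ; nat   = λ f u → ren-sub f u t }

γ₂-lam : ∀ {n} → Λ (suc n) → Exp ΛP ΛP n
γ₂-lam t' = record
  { apply = λ r e → sub (snoc (λ i → var (r i)) e) t'
  ; resp  = λ p q → sub-cong (snoc-cong (λ i → cong var (p i)) q) t'
  ; nat   = λ g r e → trans (ren-sub g (snoc (λ i → var (r i)) e) t')
                            (sub-cong (snoc-map (ren g) (λ i → var (r i)) e) t') }

γ₂-app : ∀ {n} → Res ΛP ΛP n → Λ n → Res ΛP ΛP n
γ₂-app (ι₁ p) t₂ = ι₁ (app p t₂)
γ₂-app (ι₂ φ) t₂ = ι₁ (Exp.apply φ (λ i → i) t₂)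
γ₂-app ι₃     t₂ = ι₃

γ₂ : ∀ {n} → Λ n → Res ΛP ΛP n
γ₂ (var v)     = ι₃
γ₂ (lam t')    = ι₂ (γ₂-lam t')
γ₂ (app t₁ t₂) = γ₂-app (γ₂ t₁) t₂

γ : ∀ {n} → Λ n → B ΛP ΛP n
γ t = γ₁ t , γ₂ t

private
  Res≈-refl : ∀ {n} (ρ : Res ΛP ΛP n) → Res≈ ΛP ΛP ρ ρ
  Res≈-refl (ι₁ y) = ι₁ refl
  Res≈-refl (ι₂ φ) = ι₂ (λ r e → refl)
  Res≈-refl ι₃     = ι₃

  γ₂-app-nat : ∀ {n m} (f : Fin n → Fin m) (ρ : Res ΛP ΛP n) (ρ' : Res ΛP ΛP m) (t₂ : Λ n) →
               Res≈ ΛP ΛP (Res-act ΛP ΛP f ρ) ρ' →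
               Res≈ ΛP ΛP (Res-act ΛP ΛP f (γ₂-app ρ t₂)) (γ₂-app ρ' (ren f t₂))
  γ₂-app-nat f (ι₁ p) (ι₁ p') t₂ (ι₁ q) = ι₁ (cong (λ z → app z (ren f t₂)) q)
  γ₂-app-nat f (ι₂ φ) (ι₂ ψ)  t₂ (ι₂ q) = ι₁ (trans (Exp.nat φ f (λ i → i) t₂) (q (λ i → i) (ren f t₂)))
  γ₂-app-nat f ι₃     ι₃      t₂ ι₃     = ι₃

  γ₂-nat : ∀ {n m} (f : Fin n → Fin m) (t : Λ n) → Res≈ ΛP ΛP (Res-act ΛP ΛP f (γ₂ t)) (γ₂ (ren f t))
  γ₂-nat f (var v)     = ι₃
  γ₂-nat {n} {m} f (lam t') = ι₂ λ r e →
    trans (sub-cong (λ i → sym (trans (snoc-map (snoc (λ j → var (r j)) e) (λ j → inject₁ (f j)) (fromℕ m) i)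
                                      (snoc-cong (λ j → snoc-inj (λ l → var (r l)) e (f j))
                                                 (snoc-last (λ l → var (r l)) e) i))) t')
          (sym (sub-ren (ext f) (snoc (λ i → var (r i)) e) t'))
  γ₂-nat f (app t₁ t₂) = γ₂-app-nat f (γ₂ t₁) (γ₂ (ren f t₁)) t₂ (γ₂-nat f t₁)

γ-isCoalg : IsCoalgStr ΛP ΛP γ
γ-isCoalg = record
  { str-resp = λ { {w = t} refl → (λ u → refl) , Res≈-refl (γ₂ t) }
  ; str-nat  = λ f t → (λ u → sym (sub-ren f u t)) , γ₂-nat f t }

γΛ : Coalg ΛP
γΛ = record { W = ΛP ; str = γ ; isCoalg = γ-isCoalg }

_∼Λ_ : ∀ {n} → Λ n → Λ n → Set₁
t₁ ∼Λ t₂ = γΛ ⊢ t₁ ∼ t₂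

record IsAppBisim (R : Λ 0 → Λ 0 → Set) : Set where
  field
    A1 : ∀ {t₁ t₂ t₁'} → R t₁ t₂ → t₁ ⟶ t₁' → Σ[ t₂' ∈ Λ 0 ] (t₂ ⟶ t₂') × R t₁' t₂'
    A2 : ∀ {t₁ t₂} {t₁' : Λ 1} → R t₁ t₂ → t₁ ≡ lam t₁' →
         Σ[ t₂' ∈ Λ 1 ] (t₂ ≡ lam t₂') × (∀ (e : Λ 0) → R (t₁' [ e /x]) (t₂' [ e /x]))
    A3 : ∀ {t₁ t₂ t₂'} → R t₁ t₂ → t₂ ⟶ t₂' → Σ[ t₁' ∈ Λ 0 ] (t₁ ⟶ t₁') × R t₁' t₂'
    A4 : ∀ {t₁ t₂} {t₂' : Λ 1} → R t₁ t₂ → t₂ ≡ lam t₂' →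
         Σ[ t₁' ∈ Λ 1 ] (t₁ ≡ lam t₁') × (∀ (e : Λ 0) → R (t₁' [ e /x]) (t₂' [ e /x]))

-- the greatest such relation = union of all of them
_∼ap₀_ : Λ 0 → Λ 0 → Set₁
t₁ ∼ap₀ t₂ = Σ[ R ∈ (Λ 0 → Λ 0 → Set) ] IsAppBisim R × R t₁ t₂

_∼ap_ : ∀ {n} → Λ n → Λ n → Set₁
_∼ap_ {zero}  t₁ t₂ = t₁ ∼ap₀ t₂
_∼ap_ {suc n} t₁ t₂ = ∀ (u : Fin (suc n) → Λ 0) → sub u t₁ ∼ap₀ sub u t₂

-- A sub-presheaf R ⊆ Λ × Λ underlies a bisimulation on ⟨γ₁,γ₂⟩ exactly when γ maps R-related
-- terms to pairs related by the canonical lifting of R along B(Λ,-).  Through γ₁ this says that R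
-- is closed under all substitutions; through γ₂, that related terms reduce together to related
-- terms, are abstractions together with related instances of their bodies, or are neutral
-- together.  On closed terms this is strong applicative bisimulation, and closure under closing
-- substitutions puts R inside the open extension of its closed part.
--
-- Conversely, the open extension of an applicative bisimulation is closed under substitution,
-- reduction and β-instantiation; what remains is that it relates only terms of the same shape.
-- The probes λ^p.Ω, substituted for all free variables, separate shapes: an abstraction converges
-- in 0 steps, a neutral term with j arguments converges in exactly j steps if j < p and diverges
-- otherwise, and a reducing term needs a first step while its convergence time below p does not
-- depend on p.  Applicative bisimulations preserve convergence times.

module Submission where

open import Defs
open import Data.Nat using (ℕ; zero; suc; _+_; _≤_; _<_; z≤n; s≤s; _<?_)
open import Data.Nat.Properties using (≤-refl; +-identityʳ; +-suc; +-comm; ≮⇒≥; n<1+n; <-trans; m≤n⇒m<n∨m≡n; m≤n⇒∃[o]m+o≡n)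
open import Data.Fin using (Fin; inject₁; fromℕ)
open import Data.Product using (Σ-syntax; _×_; _,_; proj₁; proj₂)
open import Data.Sum using (inj₁; inj₂)
open import Data.Empty using (⊥; ⊥-elim)
open import Relation.Nullary using (yes; no)
open import Relation.Binary.PropositionalEquality
open import Relation.Binary.Structures using (IsEquivalence)

open Psh
open Coalg

module _ {X W : Psh} (R : ∀ {n} → Ob W n → Ob W n → Set) where

  CloRel : ∀ {n} → Clo X W n → Clo X W n → Set
  CloRel {n} φ ψ = ∀ {m} (u : Fin n → Ob X m) → R (Clo.apply φ u) (Clo.apply ψ u)

  ExpRel : ∀ {n} → Exp X W n → Exp X W n → Set
  ExpRel {n} φ ψ = ∀ {k} (r : Fin n → Fin k) (e : Ob X k) → R (Exp.apply φ r e) (Exp.apply ψ r e)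

  data ResRel {n : ℕ} : Res X W n → Res X W n → Set where
    ι₁ : ∀ {y y'} → R y y' → ResRel (ι₁ y) (ι₁ y')
    ι₂ : ∀ {φ ψ} → ExpRel φ ψ → ResRel (ι₂ φ) (ι₂ ψ)
    ι₃ : ResRel ι₃ ι₃

  BRel : ∀ {n} → B X W n → B X W n → Set
  BRel (φ , ρ) (ψ , ρ') = CloRel φ ψ × ResRel ρ ρ'

ResRel-flip : ∀ {X W : Psh} {R : ∀ {n} → Ob W n → Ob W n → Set} {n} {ρ ρ' : Res X W n} →
              ResRel R ρ ρ' → ResRel (λ x y → R y x) ρ' ρ
ResRel-flip (ι₁ r) = ι₁ r
ResRel-flip (ι₂ h) = ι₂ h
ResRel-flip ι₃     = ι₃

module _ {X : Psh} {C : Coalg X} (bisim : Bisimulation C) where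
  open Bisimulation bisim
  open SubRel rel

  bisimulation⇒ResRel : ∀ {n} (P : Res X (SubPsh rel) n) {ρ ρ'} →
                        Res≈ X (W C) (Res-map (π₁ rel) P) ρ → Res≈ X (W C) (Res-map (π₂ rel) P) ρ' →
                        ResRel Rel ρ ρ'
  bisimulation⇒ResRel (ι₁ (_ , r)) (ι₁ p) (ι₁ q) = ι₁ (Rel-resp p q r)
  bisimulation⇒ResRel (ι₂ E)       (ι₂ p) (ι₂ q) =
    ι₂ λ r e → Rel-resp (p r e) (q r e) (proj₂ (Exp.apply E r e))
  bisimulation⇒ResRel ι₃           ι₃     ι₃     = ι₃

  bisimulation⇒BRel : ∀ {n} {a b : Ob (W C) n} → Rel a b → BRel Rel (str C a) (str C b)
  bisimulation⇒BRel {a = a} {b} r =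
      (λ u → Rel-resp (proj₁ hom₁ u) (proj₁ hom₂ u) (proj₂ (Clo.apply (proj₁ (rstr w)) u)))
    , bisimulation⇒ResRel (proj₂ (rstr w)) (proj₂ hom₁) (proj₂ hom₂)
    where
    w : Ob (SubPsh rel) _
    w = (a , b) , r
    hom₁ : B≈ X (W C) (B-map (π₁ rel) (rstr w)) (str C a)
    hom₁ = π₁-hom w
    hom₂ : B≈ X (W C) (B-map (π₂ rel) (rstr w)) (str C b)
    hom₂ = π₂-hom w

module _ {X : Psh} (C : Coalg X) (R : SubRel (W C))
         (lifted : ∀ {n} {a b : Ob (W C) n} → SubRel.Rel R a b →
                   BRel (SubRel.Rel R) (str C a) (str C b)) where
  open SubRel R
  open IsCoalgStr (isCoalg C)

  private
    WC : Psh
    WC = W C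
    RP : Psh
    RP = SubPsh R
    ≈-refl : ∀ {n} {x : Ob WC n} → _≈_ WC x x
    ≈-refl = IsEquivalence.refl (≈-equiv WC)

  liftClo : ∀ {n} (φ ψ : Clo X WC n) → CloRel Rel φ ψ → Clo X RP n
  liftClo φ ψ h = record
    { apply = λ u → (Clo.apply φ u , Clo.apply ψ u) , h u
    ; resp  = λ p → Clo.resp φ p , Clo.resp ψ p
    ; nat   = λ f u → Clo.nat φ f u , Clo.nat ψ f u }

  liftExp : ∀ {n} (φ ψ : Exp X WC n) → ExpRel Rel φ ψ → Exp X RP n
  liftExp φ ψ h = record
    { apply = λ r e → (Exp.apply φ r e , Exp.apply ψ r e) , h r e
    ; resp  = λ p q → Exp.resp φ p q , Exp.resp ψ p q
    ; nat   = λ g r e → Exp.nat φ g r e , Exp.nat ψ g r e }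

  liftRes : ∀ {n} {ρ ρ' : Res X WC n} → ResRel Rel ρ ρ' → Res X RP n
  liftRes (ι₁ {y} {y'} r) = ι₁ ((y , y') , r)
  liftRes (ι₂ {φ} {ψ} h)  = ι₂ (liftExp φ ψ h)
  liftRes ι₃              = ι₃

  liftRes-π₁ : ∀ {n} {ρ ρ' : Res X WC n} (h : ResRel Rel ρ ρ') → Res≈ X WC (Res-map (π₁ R) (liftRes h)) ρ
  liftRes-π₁ (ι₁ r) = ι₁ ≈-refl
  liftRes-π₁ (ι₂ h) = ι₂ λ r e → ≈-refl
  liftRes-π₁ ι₃     = ι₃

  liftRes-π₂ : ∀ {n} {ρ ρ' : Res X WC n} (h : ResRel Rel ρ ρ') → Res≈ X WC (Res-map (π₂ R) (liftRes h)) ρ'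
  liftRes-π₂ (ι₁ r) = ι₁ ≈-refl
  liftRes-π₂ (ι₂ h) = ι₂ λ r e → ≈-refl
  liftRes-π₂ ι₃     = ι₃

  liftRes-cong : ∀ {n} {ρ₁ ρ₁' ρ₂ ρ₂' : Res X WC n} → Res≈ X WC ρ₁ ρ₂ → Res≈ X WC ρ₁' ρ₂' →
                 (h₁ : ResRel Rel ρ₁ ρ₁') (h₂ : ResRel Rel ρ₂ ρ₂') → Res≈ X RP (liftRes h₁) (liftRes h₂)
  liftRes-cong (ι₁ p) (ι₁ p') (ι₁ _) (ι₁ _) = ι₁ (p , p')
  liftRes-cong (ι₂ p) (ι₂ p') (ι₂ _) (ι₂ _) = ι₂ λ r e → p r e , p' r e
  liftRes-cong ι₃     ι₃      ι₃     ι₃     = ι₃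

  liftRes-act : ∀ {n m} (f : Fin n → Fin m) {ρ₁ ρ₁' : Res X WC n} {ρ₂ ρ₂' : Res X WC m} →
                Res≈ X WC (Res-act X WC f ρ₁) ρ₂ → Res≈ X WC (Res-act X WC f ρ₁') ρ₂' →
                (h₁ : ResRel Rel ρ₁ ρ₁') (h₂ : ResRel Rel ρ₂ ρ₂') →
                Res≈ X RP (Res-act X RP f (liftRes h₁)) (liftRes h₂)
  liftRes-act f (ι₁ p) (ι₁ p') (ι₁ _) (ι₁ _) = ι₁ (p , p')
  liftRes-act f (ι₂ p) (ι₂ p') (ι₂ _) (ι₂ _) = ι₂ λ r e → p r e , p' r e
  liftRes-act f ι₃     ι₃      ι₃     ι₃     = ι₃

  liftStr : ∀ {n} → Ob RP n → B X RP n
  liftStr ((a , b) , r) =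
    liftClo (proj₁ (str C a)) (proj₁ (str C b)) (proj₁ (lifted r)) , liftRes (proj₂ (lifted r))

  liftStr-isCoalg : IsCoalgStr X RP liftStr
  liftStr-isCoalg = record
    { str-resp = λ { {w = _ , r} {w' = _ , r'} (p , q) →
          let (pφ , pρ) = str-resp p ; (qφ , qρ) = str-resp q in
          (λ u → pφ u , qφ u) , liftRes-cong pρ qρ (proj₂ (lifted r)) (proj₂ (lifted r')) }
    ; str-nat  = λ { f ((a , b) , r) →
          let (pφ , pρ) = str-nat f a ; (qφ , qρ) = str-nat f b in
          (λ u → pφ u , qφ u) , liftRes-act f pρ qρ (proj₂ (lifted r)) (proj₂ (lifted (Rel-act f r))) } }

  BRel⇒bisimulation : Bisimulation C
  BRel⇒bisimulation = record
    { rel      = R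
    ; rstr     = liftStr
    ; risCoalg = liftStr-isCoalg
    ; π₁-hom   = λ { (_ , r) → (λ u → ≈-refl) , liftRes-π₁ (proj₂ (lifted r)) }
    ; π₂-hom   = λ { (_ , r) → (λ u → ≈-refl) , liftRes-π₂ (proj₂ (lifted r)) } }

sub-id : ∀ {n} {σ : Fin n → Λ n} → (∀ i → σ i ≡ var i) → ∀ t → sub σ t ≡ t
sub-id p (var i)   = p i
sub-id {n} {σ} p (lam t) = cong lam (sub-id up-id t)
  where
  up-id : ∀ i → up σ i ≡ var i
  up-id i = trans (snoc-cong (λ j → cong (ren inject₁) (p j)) refl i)
                  (trans (sym (snoc-map var inject₁ (fromℕ n) i)) (cong var (snoc-eta (λ j → j) i)))
sub-id p (app t u) = cong₂ app (sub-id p t) (sub-id p u)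

sub-closed : (σ : Fin 0 → Λ 0) (t : Λ 0) → sub σ t ≡ t
sub-closed σ = sub-id (λ ())

sub-up : ∀ {n m k} (σ : Fin n → Λ m) (τ : Fin m → Λ k) (i : Fin (suc n)) →
         sub (up τ) (up σ i) ≡ up (λ j → sub τ (σ j)) i
sub-up {n} {m} {k} σ τ i =
  trans (snoc-map (sub (up τ)) (λ j → ren inject₁ (σ j)) (var (fromℕ m)) i)
        (snoc-cong (λ j → trans (sub-ren inject₁ (up τ) (σ j))
                          (trans (sub-cong (snoc-inj (λ l → ren inject₁ (τ l)) (var (fromℕ k))) (σ j))
                                 (sym (ren-sub inject₁ τ (σ j)))))
                   (snoc-last (λ l → ren inject₁ (τ l)) (var (fromℕ k))) i)

sub-sub : ∀ {n m k} (σ : Fin n → Λ m) (τ : Fin m → Λ k) t →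
          sub τ (sub σ t) ≡ sub (λ i → sub τ (σ i)) t
sub-sub σ τ (var i)   = refl
sub-sub σ τ (lam t)   = cong lam (trans (sub-sub (up σ) (up τ) t) (sub-cong (sub-up σ τ) t))
sub-sub σ τ (app t u) = cong₂ app (sub-sub σ τ t) (sub-sub σ τ u)

sub-snoc-weaken : ∀ {m} (e : Λ m) (t : Λ m) → sub (snoc var e) (ren inject₁ t) ≡ t
sub-snoc-weaken e t = trans (sub-ren inject₁ (snoc var e) t) (sub-id (snoc-inj var e) t)

sub-snoc-up : ∀ {n m} (τ : Fin n → Λ m) (e : Λ m) (i : Fin (suc n)) →
              sub (snoc var e) (up τ i) ≡ snoc τ e i
sub-snoc-up {n} {m} τ e i =
  trans (snoc-map (sub (snoc var e)) (λ j → ren inject₁ (τ j)) (var (fromℕ m)) i)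
        (snoc-cong (λ j → sub-snoc-weaken e (τ j)) (snoc-last var e) i)

sub-up-[/x] : ∀ {n m} (τ : Fin n → Λ m) (e : Λ m) (t : Λ (suc n)) →
              (sub (up τ) t) [ e /x] ≡ sub (snoc τ e) t
sub-up-[/x] τ e t = trans (sub-sub (up τ) (snoc var e) t) (sub-cong (sub-snoc-up τ e) t)

sub-[/x] : ∀ {n m} (σ : Fin n → Λ m) (p : Λ (suc n)) (q : Λ n) →
           sub σ (p [ q /x]) ≡ (sub (up σ) p) [ sub σ q /x]
sub-[/x] σ p q = begin
  sub σ (sub (snoc var q) p)             ≡⟨ sub-sub (snoc var q) σ p ⟩
  sub (λ i → sub σ (snoc var q i)) p     ≡⟨ sub-cong (snoc-map (sub σ) var q) p ⟩
  sub (snoc σ (sub σ q)) p               ≡⟨ sym (sub-up-[/x] σ (sub σ q) p) ⟩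
  (sub (up σ) p) [ sub σ q /x]           ∎
  where open ≡-Reasoning

⟶-det : ∀ {n} {a b c : Λ n} → a ⟶ b → a ⟶ c → b ≡ c
⟶-det (appL s) (appL s') = cong (λ z → app z _) (⟶-det s s')
⟶-det β β = refl

sub-⟶ : ∀ {n m} (σ : Fin n → Λ m) {a a'} → a ⟶ a' → sub σ a ⟶ sub σ a'
sub-⟶ σ (appL s)       = appL (sub-⟶ σ s)
sub-⟶ σ (β {p} {q}) = subst (sub σ (app (lam p) q) ⟶_) (sym (sub-[/x] σ p q)) β

data Neutral {n : ℕ} : Λ n → ℕ → Set where
  var : ∀ i → Neutral (var i) 0
  app : ∀ {t j} → Neutral t j → ∀ u → Neutral (app t u) (suc j)

data View {n : ℕ} : Λ n → Set where
  reduces     : ∀ {t t'} → t ⟶ t' → View t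
  abstraction : ∀ {t'} → View (lam t')
  neutral     : ∀ {t j} → Neutral t j → View t

view : ∀ {n} (t : Λ n) → View t
view (var i) = neutral (var i)
view (lam t) = abstraction
view (app t u) with view t
... | reduces r   = reduces (appL r)
... | abstraction = reduces β
... | neutral ne  = neutral (app ne u)

γ₂-reduces : ∀ {n} {t t' : Λ n} → t ⟶ t' → γ₂ t ≡ ι₁ t'
γ₂-reduces (appL r) rewrite γ₂-reduces r = refl
γ₂-reduces β = refl

γ₂-neutral : ∀ {n} {t : Λ n} {j} → Neutral t j → γ₂ t ≡ ι₃
γ₂-neutral (var i) = refl
γ₂-neutral (app ne u) rewrite γ₂-neutral ne = refl

ResRel-reduces : ∀ {R : ∀ {n} → Λ n → Λ n → Set} {n} {t₁ t₁' t₂ : Λ n} →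
                 ResRel R (γ₂ t₁) (γ₂ t₂) → t₁ ⟶ t₁' → Σ[ t₂' ∈ Λ n ] (t₂ ⟶ t₂') × R t₁' t₂'
ResRel-reduces {t₂ = t₂} h r₁ with view t₂
ResRel-reduces h r₁ | reduces r₂ rewrite γ₂-reduces r₁ | γ₂-reduces r₂ with h
... | ι₁ r = _ , r₂ , r
ResRel-reduces h r₁ | abstraction rewrite γ₂-reduces r₁ with h
... | ()
ResRel-reduces h r₁ | neutral ne rewrite γ₂-reduces r₁ | γ₂-neutral ne with h
... | ()

ResRel-abstraction : ∀ {R : ∀ {n} → Λ n → Λ n → Set} {n} {t₁' : Λ (suc n)} {t₂ : Λ n} →
                     ResRel R (γ₂ (lam t₁')) (γ₂ t₂) →
                     Σ[ t₂' ∈ Λ (suc n) ] (t₂ ≡ lam t₂') × (∀ e → R (t₁' [ e /x]) (t₂' [ e /x]))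
ResRel-abstraction {t₂ = t₂} h with view t₂
-- At the identity renaming, γ₂-lam t' sends e to t' [ e /x] (up to η).
ResRel-abstraction (ι₂ h) | abstraction = _ , refl , h (λ i → i)
ResRel-abstraction h | reduces r rewrite γ₂-reduces r with h
... | ()
ResRel-abstraction h | neutral ne rewrite γ₂-neutral ne with h
... | ()

ResRel⇒isAppBisim : (R : ∀ {n} → Λ n → Λ n → Set) →
                    (∀ {t₁ t₂ : Λ 0} → R t₁ t₂ → ResRel R (γ₂ t₁) (γ₂ t₂)) → IsAppBisim R
ResRel⇒isAppBisim R lifted = record
  { A1 = λ r → ResRel-reduces (lifted r)
  ; A2 = λ { {t₁' = t₁'} r refl → ResRel-abstraction {t₁' = t₁'} (lifted r) }
  ; A3 = λ r → ResRel-reduces (ResRel-flip (lifted r))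
  ; A4 = λ { {t₂' = t₂'} r refl → ResRel-abstraction {t₁' = t₂'} (ResRel-flip (lifted r)) } }

IsAppBisim-flip : ∀ {S : Λ 0 → Λ 0 → Set} → IsAppBisim S → IsAppBisim (λ x y → S y x)
IsAppBisim-flip isS = record { A1 = A3 ; A2 = A4 ; A3 = A1 ; A4 = A2 }
  where open IsAppBisim isS

IsAppBisim-⋃ : ∀ {I : Set} (S : I → Λ 0 → Λ 0 → Set) → (∀ i → IsAppBisim (S i)) →
               IsAppBisim (λ x y → Σ[ i ∈ I ] S i x y)
IsAppBisim-⋃ S isS = record
  { A1 = λ { (i , r) s → let (y , s' , r') = A1 (isS i) r s in y , s' , (i , r') }
  ; A2 = λ { (i , r) eq → let (y , eq' , h) = A2 (isS i) r eq in y , eq' , λ e → i , h e }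
  ; A3 = λ { (i , r) s → let (y , s' , r') = A3 (isS i) r s in y , s' , (i , r') }
  ; A4 = λ { (i , r) eq → let (y , eq' , h) = A4 (isS i) r eq in y , eq' , λ e → i , h e } }
  where open IsAppBisim

record Open (S : Λ 0 → Λ 0 → Set) {m : ℕ} (a b : Λ m) : Set where
  constructor by-closing
  field closing : ∀ (v : Fin m → Λ 0) → S (sub v a) (sub v b)

open Open

Open-flip : ∀ {S m} {a b : Λ m} → Open S a b → Open (λ x y → S y x) b a
Open-flip H = by-closing (closing H)

Open-sub : ∀ {S m k} {a b : Λ m} → Open S a b → (σ : Fin m → Λ k) → Open S (sub σ a) (sub σ b)
Open-sub {S} {a = a} {b} H σ = by-closing λ v →
  subst₂ S (sym (sub-sub σ v a)) (sym (sub-sub σ v b)) (closing H λ i → sub v (σ i))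

Open-ren : ∀ {S m k} (f : Fin m → Fin k) {a b : Λ m} → Open S a b → Open S (ren f a) (ren f b)
Open-ren {S} f {a} {b} H = by-closing λ v →
  subst₂ S (sym (sub-ren f v a)) (sym (sub-ren f v b)) (closing H λ i → v (f i))

OpenSubRel : (Λ 0 → Λ 0 → Set) → SubRel ΛP
OpenSubRel S = record
  { Rel      = Open S
  ; Rel-resp = λ { refl refl H → H }
  ; Rel-act  = Open-ren }

∼ap⇒Open : ∀ {n} {t₁ t₂ : Λ n} → t₁ ∼ap t₂ →
           Σ[ S ∈ (Λ 0 → Λ 0 → Set) ] IsAppBisim S × Open S t₁ t₂
∼ap⇒Open {zero} {t₁} {t₂} (S , isS , r) =
  S , isS , by-closing λ v → subst₂ S (sym (sub-closed v t₁)) (sym (sub-closed v t₂)) r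
∼ap⇒Open {suc n} h =
  (λ x y → Σ[ u ∈ (Fin (suc n) → Λ 0) ] proj₁ (h u) x y) ,
  IsAppBisim-⋃ (λ u → proj₁ (h u)) (λ u → proj₁ (proj₂ (h u))) ,
  by-closing λ u → u , proj₂ (proj₂ (h u))

Open⇒∼ap : ∀ {S n} {t₁ t₂ : Λ n} → IsAppBisim S → Open S t₁ t₂ → t₁ ∼ap t₂
Open⇒∼ap {S} {zero} {t₁} {t₂} isS H =
  S , isS , subst₂ S (sub-closed _ t₁) (sub-closed _ t₂) (closing H λ ())
Open⇒∼ap {S} {suc n} isS H u = S , isS , closing H u

∼Λ⇒Open : ∀ {n} {t₁ t₂ : Λ n} → t₁ ∼Λ t₂ →
          Σ[ S ∈ (Λ 0 → Λ 0 → Set) ] IsAppBisim S × Open S t₁ t₂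
∼Λ⇒Open (bisim , r) =
  Rel , ResRel⇒isAppBisim Rel (λ r' → proj₂ (bisimulation⇒BRel bisim r')) ,
  by-closing (proj₁ (bisimulation⇒BRel bisim r))
  where open SubRel (Bisimulation.rel bisim)

-- Convergence under the probes λ^p.Ω

infixr 5 _◅_
data _⟶⟨_⟩_ {n : ℕ} : Λ n → ℕ → Λ n → Set where
  ε   : ∀ {t} → t ⟶⟨ 0 ⟩ t
  _◅_ : ∀ {t t' k s} → t ⟶ t' → t' ⟶⟨ k ⟩ s → t ⟶⟨ suc k ⟩ s

_▻_ : ∀ {n} {x y z : Λ n} {k} → x ⟶⟨ k ⟩ y → y ⟶ z → x ⟶⟨ suc k ⟩ z
ε        ▻ r = r ◅ ε
(r' ◅ p) ▻ r = r' ◅ (p ▻ r)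

appL* : ∀ {n} {t s : Λ n} {k} (u : Λ n) → t ⟶⟨ k ⟩ s → app t u ⟶⟨ k ⟩ app s u
appL* u ε       = ε
appL* u (r ◅ p) = appL r ◅ appL* u p

infix 4 _⇓_
data _⇓_ {n : ℕ} : Λ n → ℕ → Set where
  lam⇓  : ∀ {w} → lam w ⇓ 0
  step⇓ : ∀ {x x' k} → x ⟶ x' → x' ⇓ k → x ⇓ suc k

⇓-step⁻¹ : ∀ {n} {x x' : Λ n} {k} → x ⟶ x' → x ⇓ k → Σ[ k' ∈ ℕ ] (k ≡ suc k') × x' ⇓ k'
⇓-step⁻¹ r (step⇓ r' d) rewrite ⟶-det r r' = _ , refl , d

⇓-unique : ∀ {n} {x : Λ n} {k l} → x ⇓ k → x ⇓ l → k ≡ l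
⇓-unique lam⇓          lam⇓            = refl
⇓-unique (step⇓ r d) (step⇓ r' d') rewrite ⟶-det r r' = cong suc (⇓-unique d d')

⟶⟨⟩-lam⇓ : ∀ {n} {x : Λ n} {w k} → x ⟶⟨ k ⟩ lam w → x ⇓ k
⟶⟨⟩-lam⇓ ε       = lam⇓
⟶⟨⟩-lam⇓ (r ◅ p) = step⇓ r (⟶⟨⟩-lam⇓ p)

⇓-⟶⟨⟩ : ∀ {n} {x y : Λ n} {k l} → x ⟶⟨ k ⟩ y → x ⇓ l → Σ[ l' ∈ ℕ ] y ⇓ l'
⇓-⟶⟨⟩ ε       d = _ , d
⇓-⟶⟨⟩ (r ◅ p) d = let (_ , _ , d') = ⇓-step⁻¹ r d in ⇓-⟶⟨⟩ p d'

ω : ∀ {m} → Λ m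
ω {m} = lam (app (var (fromℕ m)) (var (fromℕ m)))

Ω : ∀ {m} → Λ m
Ω = app ω ω

lamΩ : ∀ {m} → ℕ → Λ m
lamΩ zero    = Ω
lamΩ (suc p) = lam (lamΩ p)

sub-ω : ∀ {m k} (σ : Fin m → Λ k) → sub σ ω ≡ ω
sub-ω {m} {k} σ = cong lam (cong₂ app last last)
  where
  last : up σ (fromℕ m) ≡ var (fromℕ k)
  last = snoc-last (λ i → ren inject₁ (σ i)) (var (fromℕ k))

sub-lamΩ : ∀ {m k} (σ : Fin m → Λ k) p → sub σ (lamΩ p) ≡ lamΩ p
sub-lamΩ σ zero    = cong₂ app (sub-ω σ) (sub-ω σ)
sub-lamΩ σ (suc p) = cong lam (sub-lamΩ (up σ) p)

Ω⟶Ω : ∀ {m} → Ω {m} ⟶ Ω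
Ω⟶Ω {m} = subst (Ω ⟶_) (cong₂ app last last) β
  where
  last : snoc var ω (fromℕ m) ≡ ω
  last = snoc-last var ω

lamΩ-β : ∀ {m} p (u : Λ m) → app (lamΩ (suc p)) u ⟶ lamΩ p
lamΩ-β p u = subst (app (lamΩ (suc p)) u ⟶_) (sub-lamΩ (snoc var u) p) β

data ΩSpine {n : ℕ} : Λ n → Set where
  head : ΩSpine Ω
  app  : ∀ {t} → ΩSpine t → ∀ u → ΩSpine (app t u)

ΩSpine-⟶ : ∀ {n} {t : Λ n} → ΩSpine t → Σ[ t' ∈ Λ n ] (t ⟶ t') × ΩSpine t'
ΩSpine-⟶ head      = Ω , Ω⟶Ω , head
ΩSpine-⟶ (app o u) = let (t' , r , o') = ΩSpine-⟶ o in app t' u , appL r , app o' u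

ΩSpine-diverges : ∀ {n} {t : Λ n} {k} → ΩSpine t → t ⇓ k → ⊥
ΩSpine-diverges o (step⇓ r d) with ΩSpine-⟶ o
... | _ , r' , o' rewrite ⟶-det r r' = ΩSpine-diverges o' d

probe : ∀ {m} → ℕ → Fin m → Λ 0
probe p _ = lamΩ p

neutral-probe-⟶⟨⟩ : ∀ {m} {t : Λ m} {j} → Neutral t j → ∀ q → sub (probe (q + j)) t ⟶⟨ j ⟩ lamΩ q
neutral-probe-⟶⟨⟩ (var i) q rewrite +-identityʳ q = ε
neutral-probe-⟶⟨⟩ (app {j = j} ne u) q rewrite +-suc q j =
  appL* _ (neutral-probe-⟶⟨⟩ ne (suc q)) ▻ lamΩ-β q _

neutral-probe-ΩSpine : ∀ {m} {t : Λ m} {j p} → Neutral t j → p ≤ j →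
                       Σ[ s ∈ Λ 0 ] (sub (probe p) t ⟶⟨ p ⟩ s) × ΩSpine s
neutral-probe-ΩSpine (var i) z≤n = Ω , ε , head
neutral-probe-ΩSpine (app ne u) p≤1+j with m≤n⇒m<n∨m≡n p≤1+j
... | inj₁ (s≤s p≤j) =
  let (s , steps , o) = neutral-probe-ΩSpine ne p≤j in app s _ , appL* _ steps , app o _
... | inj₂ refl      = Ω , neutral-probe-⟶⟨⟩ (app ne u) 0 , head

neutral⇓ : ∀ {m} {t : Λ m} {j p} → Neutral t j → j < p → sub (probe p) t ⇓ j
neutral⇓ {j = j} ne j<p with m≤n⇒∃[o]m+o≡n j<p
... | o , refl rewrite +-comm j o = ⟶⟨⟩-lam⇓ (neutral-probe-⟶⟨⟩ ne (suc o))

neutral⇑ : ∀ {m} {t : Λ m} {j p k} → Neutral t j → p ≤ j → sub (probe p) t ⇓ k → ⊥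
neutral⇑ ne p≤j d =
  let (_ , steps , o) = neutral-probe-ΩSpine ne p≤j ; (_ , d') = ⇓-⟶⟨⟩ steps d in ΩSpine-diverges o d'

neutral⇓⁻¹ : ∀ {m} {t : Λ m} {j p k} → Neutral t j → sub (probe p) t ⇓ k → k ≡ j × j < p
neutral⇓⁻¹ {j = j} {p} ne d with j <? p
... | yes j<p = ⇓-unique d (neutral⇓ ne j<p) , j<p
... | no  j≮p = ⊥-elim (neutral⇑ ne (≮⇒≥ j≮p) d)

probe-independent : ∀ {m} (a : Λ m) {k p q} →
                    sub (probe p) a ⇓ k → k < p → k < q → sub (probe q) a ⇓ k
probe-independent a d k<p k<q with view a
probe-independent _ lam⇓ _ _ | abstraction = lam⇓
probe-independent a d k<p k<q | neutral ne with neutral⇓⁻¹ ne d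
... | refl , _ = neutral⇓ ne k<q
probe-independent a d k<p k<q | reduces {t' = a'} r with ⇓-step⁻¹ (sub-⟶ _ r) d
... | k' , refl , d' =
  step⇓ (sub-⟶ _ r) (probe-independent a' d' (<-trans (n<1+n k') k<p) (<-trans (n<1+n k') k<q))

reduces-⇓-lower-probe : ∀ {m} {a a' : Λ m} {k} → a ⟶ a' →
                        sub (probe (suc k)) a ⇓ k → sub (probe k) a ⇓ k
reduces-⇓-lower-probe {a' = a'} r d with ⇓-step⁻¹ (sub-⟶ _ r) d
... | k' , refl , d' =
  step⇓ (sub-⟶ _ r) (probe-independent a' d' (<-trans (n<1+n k') (n<1+n (suc k'))) (n<1+n k'))

⇓-transfer : ∀ {S : Λ 0 → Λ 0 → Set} {x y k} → IsAppBisim S → S x y → x ⇓ k → y ⇓ k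
⇓-transfer isS r lam⇓ with IsAppBisim.A2 isS r refl
... | _ , refl , _ = lam⇓
⇓-transfer isS r (step⇓ s d) =
  let (_ , s' , r') = IsAppBisim.A1 isS r s in step⇓ s' (⇓-transfer isS r' d)

-- Shapes are separated by the open extension

module _ {S : Λ 0 → Λ 0 → Set} (isS : IsAppBisim S) where

  lam-not-reduces : ∀ {m} {a' : Λ (suc m)} {b b'} → Open S (lam a') b → b ⟶ b' → ⊥
  lam-not-reduces H r with ⇓-step⁻¹ (sub-⟶ (probe 0) r) (⇓-transfer isS (closing H (probe 0)) lam⇓)
  ... | _ , () , _

  lam-not-neutral : ∀ {m} {a' : Λ (suc m)} {b j} → Open S (lam a') b → Neutral b j → ⊥
  lam-not-neutral H ne = neutral⇑ ne z≤n (⇓-transfer isS (closing H (probe 0)) lam⇓)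

  -- Under probe (k+1) the neutral b converges in k steps, hence so does a; since a needs a first
  -- step, it then converges in k steps under probe k as well, where b diverges.
  reduces-not-neutral : ∀ {m} {a a' b : Λ m} {k} → Open S a b → a ⟶ a' → Neutral b k → ⊥
  reduces-not-neutral {a = a} {k = k} H r ne =
    neutral⇑ ne ≤-refl (⇓-transfer isS (closing H (probe k)) (reduces-⇓-lower-probe r a⇓k))
    where
    a⇓k : sub (probe (suc k)) a ⇓ k
    a⇓k = ⇓-transfer (IsAppBisim-flip isS) (closing H (probe (suc k))) (neutral⇓ ne (n<1+n k))

module _ {S : Λ 0 → Λ 0 → Set} (isS : IsAppBisim S) where
  open IsAppBisim isS

  Open-reduces : ∀ {m} {a a' b b' : Λ m} → Open S a b → a ⟶ a' → b ⟶ b' → Open S a' b'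
  Open-reduces {a' = a'} {b' = b'} H ra rb = by-closing reduct
    where
    reduct : ∀ v → S (sub v a') (sub v b')
    reduct v with A1 (closing H v) (sub-⟶ v ra)
    ... | _ , rb' , r rewrite ⟶-det (sub-⟶ v rb) rb' = r

  Open-β : ∀ {m} {a' b' : Λ (suc m)} → Open S (lam a') (lam b') → ∀ e → Open S (a' [ e /x]) (b' [ e /x])
  Open-β {a' = a'} {b'} H e = by-closing closed-β
    where
    closed-β : ∀ v → S (sub v (a' [ e /x])) (sub v (b' [ e /x]))
    closed-β v with A2 (closing H v) refl
    ... | _ , refl , h = subst₂ S (sym (sub-[/x] v a' e)) (sym (sub-[/x] v b' e)) (h (sub v e))

  Open-instantiate : ∀ {m k} {a' b' : Λ (suc m)} → Open S (lam a') (lam b') →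
                     (τ : Fin m → Λ k) (e : Λ k) → Open S (sub (snoc τ e) a') (sub (snoc τ e) b')
  Open-instantiate {a' = a'} {b'} H τ e =
    subst₂ (Open S) (sub-up-[/x] τ e a') (sub-up-[/x] τ e b') (Open-β (Open-sub H τ) e)

  Open-ResRel : ∀ {m} {a b : Λ m} → Open S a b → ResRel (Open S) (γ₂ a) (γ₂ b)
  Open-ResRel {a = a} {b} H with view a | view b
  ... | reduces ra | reduces rb rewrite γ₂-reduces ra | γ₂-reduces rb = ι₁ (Open-reduces H ra rb)
  ... | abstraction | abstraction = ι₂ λ r e → Open-instantiate H (λ i → var (r i)) e
  ... | neutral na | neutral nb rewrite γ₂-neutral na | γ₂-neutral nb = ι₃
  ... | reduces ra | abstraction = ⊥-elim (lam-not-reduces (IsAppBisim-flip isS) (Open-flip H) ra)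
  ... | abstraction | reduces rb = ⊥-elim (lam-not-reduces isS H rb)
  ... | reduces ra | neutral nb = ⊥-elim (reduces-not-neutral isS H ra nb)
  ... | neutral na | reduces rb = ⊥-elim (reduces-not-neutral (IsAppBisim-flip isS) (Open-flip H) rb na)
  ... | abstraction | neutral nb = ⊥-elim (lam-not-neutral isS H nb)
  ... | neutral na | abstraction = ⊥-elim (lam-not-neutral (IsAppBisim-flip isS) (Open-flip H) na)

  Open⇒∼Λ : ∀ {n} {t₁ t₂ : Λ n} → Open S t₁ t₂ → t₁ ∼Λ t₂
  Open⇒∼Λ H = BRel⇒bisimulation γΛ (OpenSubRel S) (λ H' → Open-sub H' , Open-ResRel H') , H

proposition5p12 : ∀ (n : ℕ) (t₁ t₂ : Λ n) → (t₁ ∼Λ t₂ → t₁ ∼ap t₂) × (t₁ ∼ap t₂ → t₁ ∼Λ t₂)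
proposition5p12 n t₁ t₂ =
    (λ bisimilar → let (S , isS , H) = ∼Λ⇒Open bisimilar in Open⇒∼ap isS H)
  , (λ applicative → let (S , isS , H) = ∼ap⇒Open applicative in Open⇒∼Λ isS H)
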